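{- Let $G$ be a graph with $n>0$ vertices and $M=M[IAS(G)]$. Then each of the following statements is equivalent to "$G$ is connected and $n>1$": $M$ is 2-connected; $M$ is cyclically 2-connected; $M$ is vertically 2-connected.
   Context: A graph is a finite looped simple graph; $A(G)$ is its $GF(2)$ adjacency matrix (diagonal 1 iff looped). $M[IAS(G)]$ is the binary matroid represented by $(I\;A(G)\;A(G)+I)$. For a matroid $M$ on $W$ with rank $r$, $\lambda(S)=r(S)+r(W-S)-r(M)$. $S$ is an ordinary $k$-separation if $\lambda(S)<k$ and $|S|,|W-S|\ge k$; a cyclic $k$-separation if $\lambda(S)<k$ and $S,W-S$ are both dependent; a vertical $k$-separation if $\lambda(S)<k$ and $r(S),r(W-S)\ge k$. $\tau(M)$ is the least $k$ with an ordinary $k$-separation ($\infty$ if none); $\kappa^*(M)=\min(\{k\mid\text{cyclic }k\text{ -separation exists}\}\cup\{|W|-r(M)\})$; $\kappa(M)=\min(\{k\mid\text{vertical }k\text{ -separation exists}\}\cup\{r(M)\})$. $M$ is 2-connected if $\tau(M)>1$, cyclically 2-connected if $\kappa^*(M)>1$, vertically 2-connected if $\kappa(M)>1$. -}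

module Defs where

open import Data.Bool using (Bool; true; false; not; _∧_; _∨_; _xor_; if_then_else_)
open import Data.Nat using (ℕ; zero; suc; _+_; _∸_; _<_; _≤_; _⊔_)
open import Data.Fin using (Fin; splitAt; _≟_)
open import Data.Fin.Subset using (Subset; ∁; ⊤; ∣_∣)
open import Data.Vec using (Vec; []; _∷_; lookup; foldr; zipWith; allFin; toList)
import Data.List as L
open import Data.Sum using (inj₁; inj₂)
open import Data.Product using (Σ; ∃; _×_; _,_)
open import Relation.Binary.PropositionalEquality using (_≡_)
open import Relation.Nullary using (¬_; does)

record Graph (n : ℕ) : Set where
  field
    adj : Fin n → Fin n → Bool          -- A(G) over GF(2); adj v v = true iff v is looped
    sym : ∀ u v → adj u v ≡ adj v u

open Graph public

data Walk {n : ℕ} (G : Graph n) : Fin n → Fin n → Set where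
  here : ∀ {v} → Walk G v v
  step : ∀ {u w v} → adj G u w ≡ true → Walk G w v → Walk G u v

Connected : ∀ {n} → Graph n → Set
Connected {n} G = ∀ (u v : Fin n) → Walk G u v

-- Binary matroids, represented by a matrix over GF(2) = Bool (xor, ∧)
-- with r rows and m columns; the ground set W is Fin m (the columns).

record BinMatrix : Set where
  field
    rows cols : ℕ
    col : Fin cols → Fin rows → Bool

open BinMatrix public

allᵇ : {A : Set} → (A → Bool) → L.List A → Bool
allᵇ p = L.foldr (λ x acc → p x ∧ acc) true

allSubsets : (m : ℕ) → L.List (Subset m)
allSubsets zero = [] L.∷ L.[]
allSubsets (suc m) = L.map (true ∷_) (allSubsets m) L.++ L.map (false ∷_) (allSubsets m)

_⊆ᵇ_ : ∀ {m} → Subset m → Subset m → Bool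
[] ⊆ᵇ [] = true
(x ∷ xs) ⊆ᵇ (y ∷ ys) = (not x ∨ y) ∧ (xs ⊆ᵇ ys)

nonemptyᵇ : ∀ {m} → Subset m → Bool
nonemptyᵇ [] = false
nonemptyᵇ (x ∷ xs) = x ∨ nonemptyᵇ xs

colSum : (M : BinMatrix) → Subset (cols M) → Fin (rows M) → Bool
colSum M T i = foldr _ _xor_ false (zipWith (λ b j → b ∧ col M j i) T (allFin (cols M)))

isZeroᵇ : ∀ {r} → (Fin r → Bool) → Bool
isZeroᵇ {r} v = allᵇ (λ i → not (v i)) (toList (allFin r))

independentᵇ : (M : BinMatrix) → Subset (cols M) → Bool
independentᵇ M T =
  allᵇ (λ U → not ((U ⊆ᵇ T) ∧ nonemptyᵇ U ∧ isZeroᵇ (colSum M U))) (allSubsets (cols M))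

Independent : (M : BinMatrix) → Subset (cols M) → Set
Independent M T = independentᵇ M T ≡ true

Dependent : (M : BinMatrix) → Subset (cols M) → Set
Dependent M T = independentᵇ M T ≡ false

rank : (M : BinMatrix) → Subset (cols M) → ℕ
rank M S = L.foldr (λ T acc → if (T ⊆ᵇ S) ∧ independentᵇ M T then ∣ T ∣ ⊔ acc else acc)
  0 (allSubsets (cols M))

rankM : BinMatrix → ℕ
rankM M = rank M ⊤

λM : (M : BinMatrix) → Subset (cols M) → ℕ
λM M S = rank M S + rank M (∁ S) ∸ rankM M

OrdinarySep : (M : BinMatrix) → ℕ → Subset (cols M) → Set
OrdinarySep M k S = λM M S < k × k ≤ ∣ S ∣ × k ≤ ∣ ∁ S ∣

CyclicSep : (M : BinMatrix) → ℕ → Subset (cols M) → Set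
CyclicSep M k S = λM M S < k × Dependent M S × Dependent M (∁ S)

VerticalSep : (M : BinMatrix) → ℕ → Subset (cols M) → Set
VerticalSep M k S = λM M S < k × k ≤ rank M S × k ≤ rank M (∁ S)

TwoConnected : BinMatrix → Set
TwoConnected M = ∀ k → k ≤ 1 → ∀ S → ¬ OrdinarySep M k S

CyclicallyTwoConnected : BinMatrix → Set
CyclicallyTwoConnected M =
  (∀ k → k ≤ 1 → ∀ S → ¬ CyclicSep M k S) × 1 < cols M ∸ rankM M

VerticallyTwoConnected : BinMatrix → Set
VerticallyTwoConnected M =
  (∀ k → k ≤ 1 → ∀ S → ¬ VerticalSep M k S) × 1 < rankM M

-- M[IAS(G)] : represented by (I  A(G)  A(G)+I), columns Fin (n + (n + n))

idCol : ∀ {n} → Fin n → Fin n → Bool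
idCol i k = does (k ≟ i)

IAS : ∀ {n} → Graph n → BinMatrix
IAS {n} G = record { rows = n ; cols = n + (n + n) ; col = c }
  where
  c : Fin (n + (n + n)) → Fin n → Bool
  c j k with splitAt n j
  ... | inj₁ i = idCol i k
  ... | inj₂ j′ with splitAt n j′
  ...   | inj₁ i = adj G k i
  ...   | inj₂ i = adj G k i xor idCol i k

module Submission where

-- A 1-separation S of any of the three kinds has λ(S) = 0 and both sides nonempty, and the side
-- conditions |W| − r(M) > 1, r(M) > 1 hold since r(M) = n and |W| = 3n. The proof rests on:
-- (1) GF(2) linear algebra: independent columns supported on a set R of rows number at most |R|
--     (Gaussian elimination); with the identity block this gives r(M) = n.
-- (2) If G is connected and n > 1, then r(S) + r(W − S) > n whenever S, W − S ≠ ∅: some column of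
--     one side has a 1 in a row u whose identity column e u lies on the other side; adding it to
--     the identity columns on its side gives independent sets of total size n + 1.
-- (3) If G is disconnected, a set R of vertices closed under adjacency separates two vertices; the
--     columns e v, a v, e v + a v of all v ∈ R form S with λ(S) = 0, and each side contains such a
--     dependent triple, whose identity column gives it positive rank.
-- (4) If n = 1, one of the columns a, a + e is zero, giving a 1-separation {loop} | {e, parallel}.

open import Defs hiding (sym)
open import Algebra.Bundles using (CommutativeRing)
open import Data.Bool using (Bool; true; false; not; _∧_; _xor_; if_then_else_)
open import Data.Bool.Properties
  using (xor-∧-commutativeRing; xor-comm; xor-same; xor-identityʳ; ∧-assoc; ∧-distribˡ-xor; ∧-distribʳ-xor;
         ¬-not; not-involutive)
  renaming (_≟_ to _≟ᵇ_)
open import Data.Empty using (⊥-elim)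
open import Data.Fin using (Fin; zero; suc; _↑ˡ_; _↑ʳ_; splitAt; _≟_)
open import Data.Fin.Properties
  using (any?; suc-injective; ↑ʳ-injective; splitAt-↑ˡ; splitAt-↑ʳ; splitAt⁻¹-↑ˡ; splitAt⁻¹-↑ʳ)
open import Data.Fin.Subset
  using (Subset; _∈_; _∉_; _⊆_; _⊃_; _∪_; _-_; ⁅_⁆; ∁; ⊥; ⊤; ∣_∣; Nonempty; outside; inside)
open import Data.Fin.Subset.Properties
  using (_∈?_; nonempty?; Empty-unique; ∣⊥∣≡0; ∣⊤∣≡n; ∣⁅x⁆∣≡1; ∣p∣≤∣x∷p∣; ∣∁p∣≡n∸∣p∣; ∣p∣≤n;
         ∈⊤; x∈⁅x⁆; x∈⁅y⁆⇒x≡y; x≢y⇒x∉⁅y⁆; ∪-identityʳ; p─⊥≡p; drop-there; drop-∷-⊆;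
         ⊆-refl; ⊆-trans; p⊆q⇒∣p∣≤∣q∣; p⊆p∪q; q⊆p∪q; x∈p∪q⁻; p─q⊆p;
         x∈∁p⇒x∉p; x∉∁p⇒x∈p; x∉p⇒x∈∁p; x∈p⇒x∉∁p)
open import Data.Fin.Subset.Induction using (⊃-wellFounded; Acc; acc)
import Data.List as L
import Data.List.Relation.Unary.Any as Any
open import Data.List.Membership.Propositional using () renaming (_∈_ to _∈ₗ_)
open import Data.List.Membership.Propositional.Properties using (∈-map⁺; ∈-++⁺ˡ; ∈-++⁺ʳ)
open import Data.Nat using (ℕ; zero; suc; _+_; _∸_; _<_; _≤_; _⊔_; z≤n; s≤s)
open import Data.Nat.Properties
  using (≤-refl; ≤-reflexive; ≤-trans; ≤-antisym; <-≤-trans; <-irrefl; <⇒≢; n≤1+n; m≤m+n; +-comm; +-identityʳ;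
         +-mono-≤; m≤m⊔n; m≤n⊔m; ⊔-lub; m+[n∸m]≡n; m+n∸m≡n; m≤n⇒m∸n≡0; m<n⇒0<n∸m; module ≤-Reasoning)
open import Data.Product using (_×_; _,_; ∃; proj₁; proj₂)
open import Data.Sum using (_⊎_; inj₁; inj₂)
open import Data.Vec using ([]; _∷_; _++_; here; there; lookup; foldr; zipWith; tabulate; toList; allFin)
open import Data.Vec.Properties
  using ([]=⇒lookup; lookup⇒[]=; lookup-++ˡ; lookup-++ʳ; lookup-replicate; lookup∘tabulate; map-++)
open import Data.Vec.Membership.Propositional.Properties using (∈-allFin⁺; ∈-toList⁺)
open import Function using (_∘_; case_of_)
open import Function.Bundles using (_⇔_; mk⇔)
open import Relation.Binary.PropositionalEquality
open import Relation.Nullary using (¬_; Dec; yes; no; contradiction)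
open import Relation.Nullary.Decidable using (_×-dec_; ¬?; dec-true; dec-false)
open import Algebra.Properties.CommutativeSemigroup
  (CommutativeRing.+-commutativeSemigroup xor-∧-commutativeRing)
  using () renaming (interchange to xor-interchange; x∙yz≈y∙xz to xor-swap)

∧-true : ∀ {x y} → x ∧ y ≡ true → x ≡ true × y ≡ true
∧-true {true} {true} _ = refl , refl

xor-true : ∀ {x y} → x xor y ≡ true → x ≡ true ⊎ y ≡ true
xor-true {true}  _ = inj₁ refl
xor-true {false} h = inj₂ h

∣p∪⁅x⁆∣≡1+∣p∣ : ∀ {m} (p : Subset m) {x} → x ∉ p → ∣ p ∪ ⁅ x ⁆ ∣ ≡ suc ∣ p ∣
∣p∪⁅x⁆∣≡1+∣p∣ (inside  ∷ p) {zero}  x∉p = contradiction here x∉p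
∣p∪⁅x⁆∣≡1+∣p∣ (outside ∷ p) {zero}  _   = cong (suc ∘ ∣_∣) (∪-identityʳ p)
∣p∪⁅x⁆∣≡1+∣p∣ (inside  ∷ p) {suc x} x∉p = cong suc (∣p∪⁅x⁆∣≡1+∣p∣ p (x∉p ∘ there))
∣p∪⁅x⁆∣≡1+∣p∣ (outside ∷ p) {suc x} x∉p = ∣p∪⁅x⁆∣≡1+∣p∣ p (x∉p ∘ there)

∣p∣≤1+∣p-x∣ : ∀ {m} (p : Subset m) x → ∣ p ∣ ≤ suc ∣ p - x ∣
∣p∣≤1+∣p-x∣ (inside  ∷ p) zero    = ≤-reflexive (cong (suc ∘ ∣_∣) (sym (p─⊥≡p p)))
∣p∣≤1+∣p-x∣ (outside ∷ p) zero    = ≤-trans (≤-reflexive (cong ∣_∣ (sym (p─⊥≡p p)))) (n≤1+n _)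
∣p∣≤1+∣p-x∣ (inside  ∷ p) (suc x) = s≤s (∣p∣≤1+∣p-x∣ p x)
∣p∣≤1+∣p-x∣ (outside ∷ p) (suc x) = ∣p∣≤1+∣p-x∣ p x

∣p++q∣ : ∀ {a b} (p : Subset a) (q : Subset b) → ∣ p ++ q ∣ ≡ ∣ p ∣ + ∣ q ∣
∣p++q∣ []            q = refl
∣p++q∣ (inside  ∷ p) q = cong suc (∣p++q∣ p q)
∣p++q∣ (outside ∷ p) q = ∣p++q∣ p q

∣p∣+∣∁p∣≡n : ∀ {m} (p : Subset m) → ∣ p ∣ + ∣ ∁ p ∣ ≡ m
∣p∣+∣∁p∣≡n p = trans (cong (∣ p ∣ +_) (∣∁p∣≡n∸∣p∣ p)) (m+[n∸m]≡n (∣p∣≤n p))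

⁅x⁆⊆p : ∀ {m} {x} {p : Subset m} → x ∈ p → ⁅ x ⁆ ⊆ p
⁅x⁆⊆p {x = x} {p} x∈p y∈ = subst (_∈ p) (sym (x∈⁅y⁆⇒x≡y x y∈)) x∈p

1≤∣p∣ : ∀ {m} {p : Subset m} → Nonempty p → 1 ≤ ∣ p ∣
1≤∣p∣ {p = p} (x , x∈p) = subst (_≤ ∣ p ∣) (∣⁅x⁆∣≡1 x) (p⊆q⇒∣p∣≤∣q∣ (⁅x⁆⊆p x∈p))

1≤∣p∣⇒nonempty : ∀ {m} (p : Subset m) → 1 ≤ ∣ p ∣ → Nonempty p
1≤∣p∣⇒nonempty {m} p 1≤ with nonempty? p
... | yes ne    = ne
... | no  empty = contradiction (≤-trans 1≤ (≤-reflexive (trans (cong ∣_∣ (Empty-unique empty)) (∣⊥∣≡0 m))))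
                    λ ()

xorSum : ∀ {m} → Subset m → (Fin m → Bool) → Bool
xorSum []      f = false
xorSum (b ∷ U) f = (b ∧ f zero) xor xorSum U (f ∘ suc)

xorSum-zero : ∀ {m} (U : Subset m) f → (∀ {j} → j ∈ U → f j ≡ false) → xorSum U f ≡ false
xorSum-zero []            f h = refl
xorSum-zero (outside ∷ U) f h = xorSum-zero U (f ∘ suc) (h ∘ there)
xorSum-zero (inside  ∷ U) f h rewrite h here = xorSum-zero U (f ∘ suc) (h ∘ there)

xorSum-unique : ∀ {m} (U : Subset m) f {j} → j ∈ U → f j ≡ true →
                (∀ {k} → k ∈ U → f k ≡ true → k ≡ j) → xorSum U f ≡ true
xorSum-unique (inside ∷ U) f here fj unique rewrite fj = cong not (xorSum-zero U (f ∘ suc) other)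
  where
  other : ∀ {k} → k ∈ U → f (suc k) ≡ false
  other k∈U = ¬-not λ fk → contradiction (unique (there k∈U) fk) λ ()
xorSum-unique (b ∷ U) f (there j∈U) fj unique
  rewrite xorSum-unique U (f ∘ suc) j∈U fj (λ k∈U fk → suc-injective (unique (there k∈U) fk))
  = cong (_xor true) (head-vanishes b (λ { refl → here }))
  where
  head-vanishes : ∀ b′ → (b′ ≡ true → zero ∈ b ∷ U) → b′ ∧ f zero ≡ false
  head-vanishes true  0∈ = ¬-not λ f0 → contradiction (unique (0∈ refl) f0) λ ()
  head-vanishes false _  = refl

xorSum-⁅⁆ : ∀ {m} (j : Fin m) f → xorSum ⁅ j ⁆ f ≡ f j
xorSum-⁅⁆ j f with f j in fj
... | true  = xorSum-unique ⁅ j ⁆ f (x∈⁅x⁆ j) fj (λ k∈ _ → x∈⁅y⁆⇒x≡y j k∈)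
... | false = xorSum-zero ⁅ j ⁆ f λ k∈ → subst (λ k → f k ≡ false) (sym (x∈⁅y⁆⇒x≡y j k∈)) fj

xorSum-insert : ∀ {m} (U : Subset m) f {j} → j ∉ U → xorSum (U ∪ ⁅ j ⁆) f ≡ f j xor xorSum U f
xorSum-insert (inside  ∷ U) f {zero}  j∉U = contradiction here j∉U
xorSum-insert (outside ∷ U) f {zero}  _   = cong (f zero xor_) (cong (λ V → xorSum V (f ∘ suc)) (∪-identityʳ U))
xorSum-insert (inside  ∷ U) f {suc j} j∉U =
  trans (cong (f zero xor_) (xorSum-insert U (f ∘ suc) (j∉U ∘ there))) (xor-swap (f zero) (f (suc j)) _)
xorSum-insert (outside ∷ U) f {suc j} j∉U = xorSum-insert U (f ∘ suc) (j∉U ∘ there)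

xorSum-xor : ∀ {m} (U : Subset m) f g → xorSum U (λ j → f j xor g j) ≡ xorSum U f xor xorSum U g
xorSum-xor []      f g = refl
xorSum-xor (b ∷ U) f g =
  trans (cong₂ _xor_ (∧-distribˡ-xor b (f zero) (g zero)) (xorSum-xor U (f ∘ suc) (g ∘ suc)))
        (xor-interchange (b ∧ f zero) (b ∧ g zero) _ _)

xorSum-∧ʳ : ∀ {m} (U : Subset m) f d → xorSum U (λ j → f j ∧ d) ≡ xorSum U f ∧ d
xorSum-∧ʳ []      f d = refl
xorSum-∧ʳ (b ∷ U) f d =
  trans (cong₂ _xor_ (sym (∧-assoc b (f zero) d)) (xorSum-∧ʳ U (f ∘ suc) d))
        (sym (∧-distribʳ-xor d (b ∧ f zero) _))

Columns : ℕ → ℕ → Set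
Columns m r = Fin m → Fin r → Bool

sumCols : ∀ {m r} → Columns m r → Subset m → Fin r → Bool
sumCols c U i = xorSum U (λ j → c j i)

LinIndep : ∀ {m r} → Columns m r → Subset m → Set
LinIndep c T = ∀ {U} → U ⊆ T → Nonempty U → ∃ λ i → sumCols c U i ≡ true

SupportedIn : ∀ {m r} → Columns m r → Subset m → Subset r → Set
SupportedIn c T R = ∀ {j} → j ∈ T → ∀ {i} → c j i ≡ true → i ∈ R

x∉p-x : ∀ {m} (p : Subset m) x → x ∉ p - x
x∉p-x (_ ∷ p) zero    ()
x∉p-x (_ ∷ p) (suc x) (there x∈) = x∉p-x p x x∈

drop-zero-row : ∀ {m r} (c : Columns m (suc r)) T → (∀ {j} → j ∈ T → c j zero ≡ false) →
                LinIndep c T → LinIndep (λ j i → c j (suc i)) T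
drop-zero-row c T zero-row ind {U} U⊆T ne with ind U⊆T ne
... | zero  , s = contradiction (trans (sym (xorSum-zero U _ (zero-row ∘ U⊆T))) s) λ ()
... | suc i , s = i , s

-- Gaussian elimination on row 0 with pivot column p: add p to every column having a 1
-- in row 0, then delete row 0.
pivotElim : ∀ {m r} → Columns m (suc r) → Fin m → Columns m r
pivotElim c p j i = c j (suc i) xor (c j zero ∧ c p (suc i))

sumCols-pivotElim : ∀ {m r} (c : Columns m (suc r)) p U i →
  sumCols (pivotElim c p) U i ≡ sumCols c U (suc i) xor (sumCols c U zero ∧ c p (suc i))
sumCols-pivotElim c p U i =
  trans (xorSum-xor U _ _) (cong (sumCols c U (suc i) xor_) (xorSum-∧ʳ U (λ j → c j zero) _))

pivotElim-indep : ∀ {m r} (c : Columns m (suc r)) T p → p ∈ T → c p zero ≡ true →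
                  LinIndep c T → LinIndep (pivotElim c p) (T - p)
pivotElim-indep c T p p∈T pivot ind {U} U⊆T-p ne = by-row0 (sumCols c U zero) refl
  where
  U⊆T : U ⊆ T
  U⊆T = ⊆-trans U⊆T-p (p─q⊆p T ⁅ p ⁆)
  U+p⊆T : U ∪ ⁅ p ⁆ ⊆ T
  U+p⊆T j∈ with x∈p∪q⁻ U ⁅ p ⁆ j∈
  ... | inj₁ j∈U = U⊆T j∈U
  ... | inj₂ j∈p = ⁅x⁆⊆p p∈T j∈p
  insert : ∀ i → sumCols c (U ∪ ⁅ p ⁆) i ≡ c p i xor sumCols c U i
  insert i = xorSum-insert U (λ j → c j i) (x∉p-x T p ∘ U⊆T-p)
  row : ∀ {b} i → sumCols c U zero ≡ b → sumCols (pivotElim c p) U i ≡ sumCols c U (suc i) xor (b ∧ c p (suc i))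
  row i row0 = trans (sumCols-pivotElim c p U i) (cong (λ b → sumCols c U (suc i) xor (b ∧ c p (suc i))) row0)
  by-row0 : ∀ b → sumCols c U zero ≡ b → ∃ λ i → sumCols (pivotElim c p) U i ≡ true
  -- If U sums to 0 in row 0, its nonzero row survives the elimination.
  by-row0 false row0 with ind U⊆T ne
  ... | zero  , s = contradiction (trans (sym row0) s) λ ()
  ... | suc i , s = i , trans (row i row0) (trans (xor-identityʳ _) s)
  -- Otherwise U ∪ {p} sums to 0 in row 0, and its nonzero row is the eliminated sum of U.
  by-row0 true row0 with ind U+p⊆T (p , q⊆p∪q U ⁅ p ⁆ (x∈⁅x⁆ p))
  ... | zero  , s = contradiction (trans (sym (trans (insert zero) (cong₂ _xor_ pivot row0))) s) λ ()
  ... | suc i , s = i , trans (row i row0) (trans (xor-comm _ (c p (suc i))) (trans (sym (insert (suc i))) s))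

-- Dimension bound: independent columns supported on the rows R number at most |R|.
-- By induction on the number of rows, eliminating row 0 with a pivot when there is one.
dimension-bound : ∀ {m} r (c : Columns m r) T R → SupportedIn c T R → LinIndep c T → ∣ T ∣ ≤ ∣ R ∣
dimension-bound {m} zero c T R supp ind with nonempty? T
... | yes ne = case proj₁ (ind ⊆-refl ne) of λ ()
... | no empty = ≤-trans (≤-reflexive (trans (cong ∣_∣ (Empty-unique empty)) (∣⊥∣≡0 m))) z≤n
dimension-bound (suc r) c T (b ∷ R) supp ind with any? (λ j → (j ∈? T) ×-dec (c j zero ≟ᵇ true))
... | no no-pivot = ≤-trans (dimension-bound r _ T R supp′ (drop-zero-row c T zero-row ind)) (∣p∣≤∣x∷p∣ b R)
  where
  zero-row : ∀ {j} → j ∈ T → c j zero ≡ false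
  zero-row {j} j∈T = ¬-not λ e → no-pivot (j , j∈T , e)
  supp′ : SupportedIn (λ j i → c j (suc i)) T R
  supp′ j∈T e = drop-there (supp j∈T e)
... | yes (p , p∈T , pivot) with supp p∈T pivot
...   | here = ≤-trans (∣p∣≤1+∣p-x∣ T p)
                 (s≤s (dimension-bound r (pivotElim c p) (T - p) R supp′ (pivotElim-indep c T p p∈T pivot ind)))
  where
  supp′ : SupportedIn (pivotElim c p) (T - p) R
  supp′ j∈ e with xor-true e
  ... | inj₁ e′ = drop-there (supp (p─q⊆p T ⁅ p ⁆ j∈) e′)
  ... | inj₂ e′ = drop-there (supp p∈T (proj₂ (∧-true e′)))

colSum≡sumCols : ∀ M U i → colSum M U i ≡ sumCols (col M) U i
colSum≡sumCols M U i = fold≡xorSum (λ j → col M j i) (λ j → j) U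
  where
  fold≡xorSum : ∀ {m m′} (g : Fin m′ → Bool) (h : Fin m → Fin m′) T →
    foldr _ _xor_ false (zipWith (λ b j → b ∧ g j) T (tabulate h)) ≡ xorSum T (g ∘ h)
  fold≡xorSum g h []      = refl
  fold≡xorSum g h (b ∷ T) = cong ((b ∧ g (h zero)) xor_) (fold≡xorSum g (h ∘ suc) T)

∈-allSubsets : ∀ {m} (U : Subset m) → U ∈ₗ allSubsets m
∈-allSubsets []               = Any.here refl
∈-allSubsets (inside ∷ U)     = ∈-++⁺ˡ (∈-map⁺ (inside ∷_) (∈-allSubsets U))
∈-allSubsets {suc m} (outside ∷ U) =
  ∈-++⁺ʳ (L.map (inside ∷_) (allSubsets m)) (∈-map⁺ (outside ∷_) (∈-allSubsets U))

allᵇ-sound : ∀ {A : Set} (p : A → Bool) {xs x} → allᵇ p xs ≡ true → x ∈ₗ xs → p x ≡ true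
allᵇ-sound p {y L.∷ xs} h (Any.here refl) = proj₁ (∧-true h)
allᵇ-sound p {y L.∷ xs} h (Any.there x∈)  = allᵇ-sound p (proj₂ (∧-true {p y} h)) x∈

allᵇ-complete : ∀ {A : Set} (p : A → Bool) xs → (∀ x → p x ≡ true) → allᵇ p xs ≡ true
allᵇ-complete p L.[]       h = refl
allᵇ-complete p (y L.∷ xs) h rewrite h y = allᵇ-complete p xs h

not-true : ∀ {x} → not x ≡ true → x ≡ false
not-true {x} h = trans (sym (not-involutive x)) (cong not h)

isZeroᵇ-sound : ∀ {r} (v : Fin r → Bool) → isZeroᵇ v ≡ true → ∀ i → v i ≡ false
isZeroᵇ-sound v h i = not-true (allᵇ-sound (not ∘ v) h (∈-toList⁺ (∈-allFin⁺ i)))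

isZeroᵇ-witness : ∀ {r} (v : Fin r → Bool) → isZeroᵇ v ≡ false → ∃ λ i → v i ≡ true
isZeroᵇ-witness v h with any? (λ i → v i ≟ᵇ true)
... | yes w      = w
... | no nowhere = contradiction (trans (sym h) (allᵇ-complete (not ∘ v) (toList (allFin _)) λ i →
                     cong not (¬-not λ vi → nowhere (i , vi)))) λ ()

⊆ᵇ-sound : ∀ {m} (U T : Subset m) → U ⊆ᵇ T ≡ true → U ⊆ T
⊆ᵇ-sound (inside ∷ U) (inside ∷ T) h here        = here
⊆ᵇ-sound (_ ∷ U)      (_ ∷ T)      h (there j∈U) = there (⊆ᵇ-sound U T (proj₂ (∧-true h)) j∈U)
⊆ᵇ-sound (inside ∷ U) (outside ∷ T) () here

⊆ᵇ-complete : ∀ {m} (U T : Subset m) → U ⊆ T → U ⊆ᵇ T ≡ true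
⊆ᵇ-complete []            []            _   = refl
⊆ᵇ-complete (inside ∷ U)  (inside ∷ T)  U⊆T = ⊆ᵇ-complete U T (drop-∷-⊆ U⊆T)
⊆ᵇ-complete (inside ∷ U)  (outside ∷ T) U⊆T = contradiction (U⊆T here) λ ()
⊆ᵇ-complete (outside ∷ U) (_ ∷ T)       U⊆T = ⊆ᵇ-complete U T (drop-∷-⊆ U⊆T)

nonemptyᵇ-sound : ∀ {m} (U : Subset m) → nonemptyᵇ U ≡ true → Nonempty U
nonemptyᵇ-sound (inside ∷ U)  _ = zero , here
nonemptyᵇ-sound (outside ∷ U) h with nonemptyᵇ-sound U h
... | j , j∈U = suc j , there j∈U

nonemptyᵇ-complete : ∀ {m} (U : Subset m) → Nonempty U → nonemptyᵇ U ≡ true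
nonemptyᵇ-complete (inside ∷ U)  _                 = refl
nonemptyᵇ-complete (outside ∷ U) (suc j , there j∈U) = nonemptyᵇ-complete U (j , j∈U)

independent⇒LinIndep : ∀ M T → Independent M T → LinIndep (col M) T
independent⇒LinIndep M T h {U} U⊆T ne with allᵇ-sound _ h (∈-allSubsets U)
... | test rewrite ⊆ᵇ-complete U T U⊆T | nonemptyᵇ-complete U ne
  with isZeroᵇ-witness (colSum M U) (not-true test)
...   | i , s = i , trans (sym (colSum≡sumCols M U i)) s

LinIndep⇒independent : ∀ M T → LinIndep (col M) T → Independent M T
LinIndep⇒independent M T ind = allᵇ-complete _ (allSubsets (cols M)) no-zero-subsum
  where
  no-zero-subsum : ∀ U → not ((U ⊆ᵇ T) ∧ nonemptyᵇ U ∧ isZeroᵇ (colSum M U)) ≡ true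
  no-zero-subsum U with U ⊆ᵇ T in sub | nonemptyᵇ U in ne | isZeroᵇ (colSum M U) in zero
  ... | true  | true  | true  with ind (⊆ᵇ-sound U T sub) (nonemptyᵇ-sound U ne)
  ...   | i , s = contradiction (trans (sym (isZeroᵇ-sound _ zero i)) (trans (colSum≡sumCols M U i) s)) λ ()
  no-zero-subsum U | true  | true  | false = refl
  no-zero-subsum U | true  | false | _     = refl
  no-zero-subsum U | false | _     | _     = refl

dependent-witness : ∀ M T U → U ⊆ T → Nonempty U → (∀ i → sumCols (col M) U i ≡ false) → Dependent M T
dependent-witness M T U U⊆T ne zero-sum = ¬-not λ indep →
  let (i , s) = independent⇒LinIndep M T indep U⊆T ne in contradiction (trans (sym (zero-sum i)) s) λ ()

-- The empty family is independent, so a dependent set is nonempty.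
dependent⇒nonempty : ∀ M T → Dependent M T → Nonempty T
dependent⇒nonempty M T dep with nonempty? T
... | yes ne    = ne
... | no  empty = contradiction (trans (sym dep) (LinIndep⇒independent M T λ {U} U⊆T (j , j∈U) →
                    contradiction (j , U⊆T j∈U) empty)) λ ()

rankOver : ∀ M → Subset (cols M) → L.List (Subset (cols M)) → ℕ
rankOver M S = L.foldr (λ T acc → if (T ⊆ᵇ S) ∧ independentᵇ M T then ∣ T ∣ ⊔ acc else acc) 0

rank-lb : ∀ M S T → T ⊆ S → LinIndep (col M) T → ∣ T ∣ ≤ rank M S
rank-lb M S T T⊆S ind = go (allSubsets (cols M)) (∈-allSubsets T)
  where
  candidate : (T ⊆ᵇ S) ∧ independentᵇ M T ≡ true
  candidate rewrite ⊆ᵇ-complete T S T⊆S = LinIndep⇒independent M T ind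
  go : ∀ xs → T ∈ₗ xs → ∣ T ∣ ≤ rankOver M S xs
  go (.T L.∷ xs) (Any.here refl) rewrite candidate = m≤m⊔n _ _
  go (U L.∷ xs) (Any.there T∈) with (U ⊆ᵇ S) ∧ independentᵇ M U
  ... | true  = ≤-trans (go xs T∈) (m≤n⊔m _ _)
  ... | false = go xs T∈

rank-ub : ∀ M S b → (∀ T → T ⊆ S → LinIndep (col M) T → ∣ T ∣ ≤ b) → rank M S ≤ b
rank-ub M S b bound = go (allSubsets (cols M))
  where
  go : ∀ xs → rankOver M S xs ≤ b
  go L.[] = z≤n
  go (U L.∷ xs) with U ⊆ᵇ S in sub | independentᵇ M U in indep
  ... | true  | true  = ⊔-lub (bound U (⊆ᵇ-sound U S sub) (independent⇒LinIndep M U indep)) (go xs)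
  ... | true  | false = go xs
  ... | false | _     = go xs

rank-supported : ∀ M S R → SupportedIn (col M) S R → rank M S ≤ ∣ R ∣
rank-supported M S R supp = rank-ub M S ∣ R ∣ λ T T⊆S ind →
  dimension-bound (rows M) (col M) T R (supp ∘ T⊆S) ind

rank-nonzero-column : ∀ M S {j i} → j ∈ S → col M j i ≡ true → 1 ≤ rank M S
rank-nonzero-column M S {j} {i} j∈S hot =
  subst (_≤ rank M S) (∣⁅x⁆∣≡1 j) (rank-lb M S ⁅ j ⁆ (⁅x⁆⊆p j∈S) single)
  where
  single : LinIndep (col M) ⁅ j ⁆
  single {U} U⊆ (k , k∈U) = i , xorSum-unique U _ (subst (_∈ U) (x∈⁅y⁆⇒x≡y j (U⊆ k∈U)) k∈U) hot
                                  (λ l∈U _ → x∈⁅y⁆⇒x≡y j (U⊆ l∈U))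

-- A set of rank ≥ 1 is nonempty: the empty set is supported on no rows.
1≤rank⇒nonempty : ∀ M S → 1 ≤ rank M S → Nonempty S
1≤rank⇒nonempty M S 1≤r with nonempty? S
... | yes ne    = ne
... | no  empty = contradiction (≤-trans 1≤r (≤-trans (rank-supported M S ⊥ nowhere) (≤-reflexive (∣⊥∣≡0 (rows M)))))
                    λ ()
  where
  nowhere : SupportedIn (col M) S ⊥
  nowhere j∈S = contradiction (_ , j∈S) empty

loop-dependent : ∀ M T {j} → j ∈ T → (∀ i → col M j i ≡ false) → Dependent M T
loop-dependent M T {j} j∈T zero-col = dependent-witness M T ⁅ j ⁆ (⁅x⁆⊆p j∈T) (j , x∈⁅x⁆ j)
  (λ i → trans (xorSum-⁅⁆ j (λ k → col M k i)) (zero-col i))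

parallel-dependent : ∀ M T {j k} → ¬ k ≡ j → j ∈ T → k ∈ T → (∀ i → col M j i ≡ col M k i) → Dependent M T
parallel-dependent M T {j} {k} k≢j j∈T k∈T equal = dependent-witness M T (⁅ j ⁆ ∪ ⁅ k ⁆) pair⊆T
  (k , q⊆p∪q ⁅ j ⁆ ⁅ k ⁆ (x∈⁅x⁆ k)) zero-sum
  where
  pair⊆T : ⁅ j ⁆ ∪ ⁅ k ⁆ ⊆ T
  pair⊆T l∈ with x∈p∪q⁻ ⁅ j ⁆ ⁅ k ⁆ l∈
  ... | inj₁ l∈j = ⁅x⁆⊆p j∈T l∈j
  ... | inj₂ l∈k = ⁅x⁆⊆p k∈T l∈k
  zero-sum : ∀ i → sumCols (col M) (⁅ j ⁆ ∪ ⁅ k ⁆) i ≡ false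
  zero-sum i = trans (xorSum-insert ⁅ j ⁆ (λ l → col M l i) (k≢j ∘ x∈⁅y⁆⇒x≡y j))
                     (trans (cong (col M k i xor_) (trans (xorSum-⁅⁆ j (λ l → col M l i)) (equal i)))
                            (xor-same (col M k i)))

small-separation : ∀ {x k} → x < k → k ≤ 1 → x ≡ 0 × k ≡ 1
small-separation {zero}  {suc zero}    _         _         = refl , refl
small-separation {suc _} {suc zero}    (s≤s ())  _
small-separation {_}     {suc (suc _)} _         (s≤s ())

PositiveOnSplits : BinMatrix → Set
PositiveOnSplits M = ∀ S → Nonempty S → Nonempty (∁ S) → 0 < λM M S

-- Both sides of an ordinary, cyclic or vertical k-separation with k ≤ 1 are nonempty,
-- so none exists when λ is positive on splits.
twoConnected-if : ∀ M → PositiveOnSplits M → TwoConnected M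
twoConnected-if M pos k k≤1 S (λ<k , k≤S , k≤∁S) with small-separation λ<k k≤1
... | λ≡0 , refl = <⇒≢ (pos S (1≤∣p∣⇒nonempty S k≤S) (1≤∣p∣⇒nonempty (∁ S) k≤∁S)) (sym λ≡0)

cyclicallyTwoConnected-if : ∀ M → PositiveOnSplits M → 1 < cols M ∸ rankM M → CyclicallyTwoConnected M
cyclicallyTwoConnected-if M pos corank = no-sep , corank
  where
  no-sep : ∀ k → k ≤ 1 → ∀ S → ¬ CyclicSep M k S
  no-sep k k≤1 S (λ<k , dep , dep∁) with small-separation λ<k k≤1
  ... | λ≡0 , refl = <⇒≢ (pos S (dependent⇒nonempty M S dep) (dependent⇒nonempty M (∁ S) dep∁)) (sym λ≡0)

verticallyTwoConnected-if : ∀ M → PositiveOnSplits M → 1 < rankM M → VerticallyTwoConnected M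
verticallyTwoConnected-if M pos rank>1 = no-sep , rank>1
  where
  no-sep : ∀ k → k ≤ 1 → ∀ S → ¬ VerticalSep M k S
  no-sep k k≤1 S (λ<k , k≤rS , k≤r∁S) with small-separation λ<k k≤1
  ... | λ≡0 , refl = <⇒≢ (pos S (1≤rank⇒nonempty M S k≤rS) (1≤rank⇒nonempty M (∁ S) k≤r∁S)) (sym λ≡0)

not-twoConnected : ∀ M S → λM M S ≡ 0 → Nonempty S → Nonempty (∁ S) → ¬ TwoConnected M
not-twoConnected M S λ≡0 ne ne∁ h = h 1 ≤-refl S (s≤s (≤-reflexive λ≡0) , 1≤∣p∣ ne , 1≤∣p∣ ne∁)

not-cyclicallyTwoConnected : ∀ M S → λM M S ≡ 0 → Dependent M S → Dependent M (∁ S) → ¬ CyclicallyTwoConnected M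
not-cyclicallyTwoConnected M S λ≡0 dep dep∁ (h , _) = h 1 ≤-refl S (s≤s (≤-reflexive λ≡0) , dep , dep∁)

not-verticallyTwoConnected : ∀ M S → λM M S ≡ 0 → 1 ≤ rank M S → 1 ≤ rank M (∁ S) → ¬ VerticallyTwoConnected M
not-verticallyTwoConnected M S λ≡0 r r∁ (h , _) = h 1 ≤-refl S (s≤s (≤-reflexive λ≡0) , r , r∁)

leaving-edge : ∀ {n} (G : Graph n) (Q : Subset n) {u w} → Walk G u w → u ∈ Q → w ∉ Q →
               ∃ λ a → ∃ λ b → adj G a b ≡ true × a ∈ Q × b ∉ Q
leaving-edge G Q here                 u∈Q w∉Q = contradiction u∈Q w∉Q
leaving-edge G Q (step {w = x} e rest) u∈Q w∉Q with x ∈? Q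
... | yes x∈Q = leaving-edge G Q rest x∈Q w∉Q
... | no  x∉Q = _ , x , e , u∈Q , x∉Q

another-vertex : ∀ {n} → 1 < n → (v : Fin n) → ∃ λ w → ¬ w ≡ v
another-vertex {suc zero}    (s≤s ()) zero
another-vertex {suc (suc _)} _ zero    = suc zero , λ ()
another-vertex {suc (suc _)} _ (suc v) = zero , λ ()

other-neighbour : ∀ {n} (G : Graph n) → Connected G → 1 < n → ∀ v → ∃ λ b → adj G v b ≡ true × ¬ b ≡ v
other-neighbour G conn n>1 v with another-vertex n>1 v
... | w , w≢v with leaving-edge G ⁅ v ⁆ (conn v w) (x∈⁅x⁆ v) (w≢v ∘ x∈⁅y⁆⇒x≡y v)
...   | a , b , ab , a∈ , b∉ rewrite x∈⁅y⁆⇒x≡y v a∈ = b , ab , λ b≡v → b∉ (subst (_∈ ⁅ v ⁆) (sym b≡v) (x∈⁅x⁆ v))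

Closed : ∀ {n} → Graph n → Subset n → Set
Closed G R = ∀ {x y} → x ∈ R → adj G x y ≡ true → y ∈ R

module Components {n : ℕ} (G : Graph n) where

  walk-snoc : ∀ {u x y} → Walk G u x → adj G x y ≡ true → Walk G u y
  walk-snoc here        xy = step xy here
  walk-snoc (step e w) xy = step e (walk-snoc w xy)

  -- Starting from {u}, add an out-neighbour of the current set while there is one; since ⊃ is
  -- well-founded on subsets this stops, at a closed set of vertices reachable from u.
  reachable-closure : ∀ u → ∃ λ R → Closed G R × u ∈ R × (∀ {x} → x ∈ R → Walk G u x)
  reachable-closure u =
    grow ⁅ u ⁆ (⊃-wellFounded ⁅ u ⁆) (x∈⁅x⁆ u) λ x∈ → subst (Walk G u) (sym (x∈⁅y⁆⇒x≡y u x∈)) here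
    where
    grow : ∀ R → Acc _⊃_ R → u ∈ R → (∀ {x} → x ∈ R → Walk G u x) →
           ∃ λ R → Closed G R × u ∈ R × (∀ {x} → x ∈ R → Walk G u x)
    grow R (acc larger) u∈R walks
      with any? (λ x → any? (λ y → x ∈? R ×-dec adj G x y ≟ᵇ true ×-dec ¬? (y ∈? R)))
    ... | no none = R , closed , u∈R , walks
      where
      closed : Closed G R
      closed {x} {y} x∈R xy with y ∈? R
      ... | yes y∈R = y∈R
      ... | no  y∉R = contradiction (x , y , x∈R , xy , y∉R) none
    ... | yes (x , y , x∈R , xy , y∉R) =
      grow (R ∪ ⁅ y ⁆) (larger (p⊆p∪q ⁅ y ⁆ , y , q⊆p∪q R ⁅ y ⁆ (x∈⁅x⁆ y) , y∉R)) (p⊆p∪q ⁅ y ⁆ u∈R) walks′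
      where
      walks′ : ∀ {z} → z ∈ R ∪ ⁅ y ⁆ → Walk G u z
      walks′ z∈ with x∈p∪q⁻ R ⁅ y ⁆ z∈
      ... | inj₁ z∈R = walks z∈R
      ... | inj₂ z∈y = subst (Walk G u) (sym (x∈⁅y⁆⇒x≡y y z∈y)) (walk-snoc (walks x∈R) xy)

  connected-if-uncut : (∀ {R u v} → Closed G R → u ∈ R → v ∉ R → Data.Empty.⊥) → Connected G
  connected-if-uncut uncut u v with reachable-closure u
  ... | R , closed , u∈R , walks with v ∈? R
  ...   | yes v∈R = walks v∈R
  ...   | no  v∉R = ⊥-elim (uncut closed u∈R v∉R)

  -- Adjacency is symmetric, so the complement of a closed set is closed.
  Closed-∁ : ∀ {R} → Closed G R → Closed G (∁ R)
  Closed-∁ {R} closed {x} {y} x∈∁R xy with y ∈? R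
  ... | yes y∈R = contradiction (closed y∈R (trans (Graph.sym G y x) xy)) (x∈∁p⇒x∉p x∈∁R)
  ... | no  y∉R = x∉p⇒x∈∁p y∉R

∈-by-lookup : ∀ {m k} {p : Subset m} {q : Subset k} {x y} → lookup p x ≡ lookup q y → x ∈ p → y ∈ q
∈-by-lookup {q = q} {y = y} e x∈p = lookup⇒[]= y q (trans (sym e) ([]=⇒lookup x∈p))

idCol-diag : ∀ {n} (v : Fin n) → idCol v v ≡ true
idCol-diag v = dec-true (v ≟ v) refl

idCol-off : ∀ {n} {v k : Fin n} → ¬ k ≡ v → idCol v k ≡ false
idCol-off {v = v} {k} k≢v = dec-false (k ≟ v) k≢v

idCol-true : ∀ {n} (v k : Fin n) → idCol v k ≡ true → k ≡ v
idCol-true v k h with k ≟ v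
... | yes k≡v = k≡v

↑ˡ≢↑ʳ : ∀ {m k} (x : Fin m) (y : Fin k) → ¬ x ↑ˡ k ≡ m ↑ʳ y
↑ˡ≢↑ʳ {m} {k} x y eq with trans (sym (splitAt-↑ˡ m x k)) (trans (cong (splitAt m) eq) (splitAt-↑ʳ m k y))
... | ()

-- The ground set of M[IAS(G)] consists of three blocks of n columns:
-- e v (identity), a v (column v of A(G)) and ae v (column v of A(G) + I).
module GroundSet (n : ℕ) where

  eᵢ aᵢ aeᵢ : Fin n → Fin (n + (n + n))
  eᵢ  v = v ↑ˡ (n + n)
  aᵢ  v = n ↑ʳ (v ↑ˡ n)
  aeᵢ v = n ↑ʳ (n ↑ʳ v)

  data Block : Fin (n + (n + n)) → Set where
    e-block  : ∀ v → Block (eᵢ v)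
    a-block  : ∀ v → Block (aᵢ v)
    ae-block : ∀ v → Block (aeᵢ v)

  block : ∀ j → Block j
  block j with splitAt n j in eq
  ... | inj₁ v = subst Block (splitAt⁻¹-↑ˡ eq) (e-block v)
  ... | inj₂ j′ with splitAt n j′ in eq′
  ...   | inj₁ v = subst Block (trans (cong (n ↑ʳ_) (splitAt⁻¹-↑ˡ eq′)) (splitAt⁻¹-↑ʳ eq)) (a-block v)
  ...   | inj₂ v = subst Block (trans (cong (n ↑ʳ_) (splitAt⁻¹-↑ʳ eq′)) (splitAt⁻¹-↑ʳ eq)) (ae-block v)

  e≢a : ∀ v w → ¬ eᵢ v ≡ aᵢ w
  e≢a v w = ↑ˡ≢↑ʳ v (w ↑ˡ n)

  e≢ae : ∀ v w → ¬ eᵢ v ≡ aeᵢ w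
  e≢ae v w = ↑ˡ≢↑ʳ v (n ↑ʳ w)

  a≢ae : ∀ v w → ¬ aᵢ v ≡ aeᵢ w
  a≢ae v w eq = ↑ˡ≢↑ʳ v w (↑ʳ-injective n _ _ eq)

module IAS-columns {n : ℕ} (G : Graph n) where

  open GroundSet n

  M : BinMatrix
  M = IAS G

  col-e : ∀ v k → col M (eᵢ v) k ≡ idCol v k
  col-e v k rewrite splitAt-↑ˡ n v (n + n) = refl

  col-a : ∀ v k → col M (aᵢ v) k ≡ adj G k v
  col-a v k rewrite splitAt-↑ʳ n (n + n) (v ↑ˡ n) | splitAt-↑ˡ n v n = refl

  col-ae : ∀ v k → col M (aeᵢ v) k ≡ adj G k v xor idCol v k
  col-ae v k rewrite splitAt-↑ʳ n (n + n) (n ↑ʳ v) | splitAt-↑ʳ n n v = refl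

  col-e-diag : ∀ v → col M (eᵢ v) v ≡ true
  col-e-diag v = trans (col-e v v) (idCol-diag v)

  eSet : Subset n → Subset (n + (n + n))
  eSet V = V ++ ⊥

  right∉eSet : ∀ {V} y → n ↑ʳ y ∉ eSet V
  right∉eSet {V} y y∈ =
    contradiction (trans (sym (trans (lookup-++ʳ V ⊥ y) (lookup-replicate y false))) ([]=⇒lookup y∈)) λ ()

  eSet-only-e : ∀ {V j} → j ∈ eSet V → ∃ λ v → j ≡ eᵢ v × v ∈ V
  eSet-only-e {V} {j} j∈ with block j
  ... | e-block v  = v , refl , ∈-by-lookup (lookup-++ˡ V ⊥ v) j∈
  ... | a-block v  = contradiction j∈ (right∉eSet (v ↑ˡ n))
  ... | ae-block v = contradiction j∈ (right∉eSet (n ↑ʳ v))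

  ∣eSet∣ : ∀ V → ∣ eSet V ∣ ≡ ∣ V ∣
  ∣eSet∣ V = trans (∣p++q∣ V ⊥) (trans (cong (∣ V ∣ +_) (∣⊥∣≡0 (n + n))) (+-identityʳ _))

  sum-eColumns : ∀ {U v} → (∀ {j} → j ∈ U → ∃ λ w → j ≡ eᵢ w) → eᵢ v ∈ U → sumCols (col M) U v ≡ true
  sum-eColumns {U} {v} only-e e∈U = xorSum-unique U _ e∈U (col-e-diag v) unique
    where
    unique : ∀ {k} → k ∈ U → col M k v ≡ true → k ≡ eᵢ v
    unique k∈U hot with only-e k∈U
    ... | w , refl = cong eᵢ (sym (idCol-true w v (trans (sym (col-e w v)) hot)))

  eSet-indep : ∀ V → LinIndep (col M) (eSet V)
  eSet-indep V {U} U⊆ (j , j∈U) with eSet-only-e (U⊆ j∈U)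
  ... | v , refl , _ = v , sum-eColumns only-e j∈U
    where
    only-e : ∀ {k} → k ∈ U → ∃ λ w → k ≡ eᵢ w
    only-e k∈U with eSet-only-e (U⊆ k∈U)
    ... | w , k≡ , _ = w , k≡

  -- Adding a column j with a 1 in a row u ∉ V to {e v | v ∈ V} gives a larger independent set:
  -- in row u, only j contributes.
  eSet-extend : ∀ V {j u} → u ∉ V → col M j u ≡ true → j ∉ eSet V × LinIndep (col M) (eSet V ∪ ⁅ j ⁆)
  eSet-extend V {j} {u} u∉V hot = j-new , indep
    where
    e-cold : ∀ {k} → k ∈ eSet V → col M k u ≡ false
    e-cold k∈ with eSet-only-e k∈
    ... | w , refl , w∈V = ¬-not λ h → u∉V (subst (_∈ V) (sym (idCol-true w u (trans (sym (col-e w u)) h))) w∈V)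
    j-new : j ∉ eSet V
    j-new j∈ = contradiction (trans (sym hot) (e-cold j∈)) λ ()
    indep : LinIndep (col M) (eSet V ∪ ⁅ j ⁆)
    indep {U} U⊆ ne with j ∈? U
    ... | yes j∈U = u , xorSum-unique U _ j∈U hot unique
      where
      unique : ∀ {k} → k ∈ U → col M k u ≡ true → k ≡ j
      unique k∈U h with x∈p∪q⁻ (eSet V) ⁅ j ⁆ (U⊆ k∈U)
      ... | inj₁ k∈e = contradiction (trans (sym h) (e-cold k∈e)) λ ()
      ... | inj₂ k∈j = x∈⁅y⁆⇒x≡y j k∈j
    ... | no j∉U = eSet-indep V U⊆eSet ne
      where
      U⊆eSet : U ⊆ eSet V
      U⊆eSet k∈U with x∈p∪q⁻ (eSet V) ⁅ j ⁆ (U⊆ k∈U)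
      ... | inj₁ k∈e = k∈e
      ... | inj₂ k∈j = contradiction (subst (_∈ U) (x∈⁅y⁆⇒x≡y j k∈j) k∈U) j∉U

  -- r(M) = n: the identity block is a basis.
  rankM≡n : rankM M ≡ n
  rankM≡n = ≤-antisym
    (subst (rankM M ≤_) (∣⊤∣≡n n) (rank-supported M ⊤ ⊤ λ _ _ → ∈⊤))
    (subst (_≤ rankM M) (trans (∣eSet∣ ⊤) (∣⊤∣≡n n)) (rank-lb M ⊤ (eSet ⊤) (λ _ → ∈⊤) (eSet-indep ⊤)))

  eTrace : Subset (n + (n + n)) → Subset n
  eTrace S = tabulate (λ v → lookup S (eᵢ v))

  eTrace⁺ : ∀ {S v} → eᵢ v ∈ S → v ∈ eTrace S
  eTrace⁺ {S} {v} = ∈-by-lookup (sym (lookup∘tabulate (λ w → lookup S (eᵢ w)) v))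

  eTrace⁻ : ∀ {S v} → v ∈ eTrace S → eᵢ v ∈ S
  eTrace⁻ {S} {v} = ∈-by-lookup (lookup∘tabulate (λ w → lookup S (eᵢ w)) v)

  -- Key lemma. Let S and S′ cover the ground set. If some j ∈ S has a 1 in a row u with e u ∉ S,
  -- then {e v ∈ S} ∪ {j} ⊆ S and {e v ∉ S} ⊆ S′ are independent sets of total size n + 1.
  crossing-column : ∀ S S′ → (∀ {x} → x ∉ S → x ∈ S′) → ∀ {j u} → j ∈ S → eᵢ u ∉ S →
                    col M j u ≡ true → suc n ≤ rank M S + rank M S′
  crossing-column S S′ cover {j} {u} j∈S eu∉S hot = begin
    suc n                               ≡⟨ cong suc (∣p∣+∣∁p∣≡n V) ⟨
    suc (∣ V ∣ + ∣ ∁ V ∣)                ≡⟨ cong₂ (λ a b → suc a + b) (∣eSet∣ V) (∣eSet∣ (∁ V)) ⟨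
    suc ∣ eSet V ∣ + ∣ eSet (∁ V) ∣       ≡⟨ cong (_+ ∣ eSet (∁ V) ∣) (∣p∪⁅x⁆∣≡1+∣p∣ (eSet V) j-new) ⟨
    ∣ eSet V ∪ ⁅ j ⁆ ∣ + ∣ eSet (∁ V) ∣    ≤⟨ +-mono-≤ (rank-lb M S _ T₁⊆S T₁-indep)
                                                      (rank-lb M S′ _ T₂⊆S′ (eSet-indep (∁ V))) ⟩
    rank M S + rank M S′                ∎
    where
    open ≤-Reasoning
    V : Subset n
    V = eTrace S
    extended : j ∉ eSet V × LinIndep (col M) (eSet V ∪ ⁅ j ⁆)
    extended = eSet-extend V (eu∉S ∘ eTrace⁻) hot
    j-new : j ∉ eSet V
    j-new = proj₁ extended
    T₁-indep : LinIndep (col M) (eSet V ∪ ⁅ j ⁆)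
    T₁-indep = proj₂ extended
    T₁⊆S : eSet V ∪ ⁅ j ⁆ ⊆ S
    T₁⊆S k∈ with x∈p∪q⁻ (eSet V) ⁅ j ⁆ k∈
    ... | inj₁ k∈e with eSet-only-e k∈e
    ...   | v , refl , v∈V = eTrace⁻ v∈V
    T₁⊆S k∈ | inj₂ k∈j = ⁅x⁆⊆p j∈S k∈j
    T₂⊆S′ : eSet (∁ V) ⊆ S′
    T₂⊆S′ k∈ with eSet-only-e k∈
    ... | v , refl , v∈∁V = cover λ ev∈S → x∈∁p⇒x∉p v∈∁V (eTrace⁺ ev∈S)

module Forward {n : ℕ} (G : Graph n) where

  open GroundSet n
  open IAS-columns G

  -- Every column is nonzero: e v in row v, and a v, ae v in the row of a neighbour b ≠ v.
  column-nonzero : Connected G → 1 < n → ∀ j → ∃ λ u → col M j u ≡ true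
  column-nonzero conn n>1 j with block j
  ... | e-block v = v , col-e-diag v
  ... | a-block v with other-neighbour G conn n>1 v
  ...   | b , vb , b≢v = b , trans (col-a v b) (trans (Graph.sym G b v) vb)
  column-nonzero conn n>1 j | ae-block v with other-neighbour G conn n>1 v
  ...   | b , vb , b≢v = b , trans (col-ae v b) (cong₂ _xor_ (trans (Graph.sym G b v) vb) (idCol-off b≢v))

  inside-crossing : ∀ S {j u} → j ∈ S → eᵢ u ∉ S → col M j u ≡ true → suc n ≤ rank M S + rank M (∁ S)
  inside-crossing S = crossing-column S (∁ S) x∉p⇒x∈∁p

  outside-crossing : ∀ S {j u} → j ∉ S → eᵢ u ∈ S → col M j u ≡ true → suc n ≤ rank M S + rank M (∁ S)
  outside-crossing S j∉S eu∈S hot =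
    subst (suc n ≤_) (+-comm (rank M (∁ S)) (rank M S))
      (crossing-column (∁ S) S x∉∁p⇒x∈p (x∉p⇒x∈∁p j∉S) (x∈p⇒x∉∁p eu∈S) hot)

  -- An edge ab with e a ∈ S and e b ∉ S: if a a or ae a lies in S it has a 1 in row b;
  -- otherwise both lie outside S and one of them has a 1 in row a.
  edge-across : ∀ S {a b} → adj G a b ≡ true → eᵢ a ∈ S → eᵢ b ∉ S → suc n ≤ rank M S + rank M (∁ S)
  edge-across S {a} {b} ab ea∈S eb∉S = by-cases (aᵢ a ∈? S) (aeᵢ a ∈? S) (adj G a a) refl
    where
    ba : adj G b a ≡ true
    ba = trans (Graph.sym G b a) ab
    b≢a : ¬ b ≡ a
    b≢a refl = eb∉S ea∈S
    by-cases : Dec (aᵢ a ∈ S) → Dec (aeᵢ a ∈ S) → ∀ l → adj G a a ≡ l → suc n ≤ rank M S + rank M (∁ S)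
    by-cases (yes aa∈S) _          _     _    = inside-crossing S aa∈S eb∉S (trans (col-a a b) ba)
    by-cases (no _)     (yes ae∈S) _     _    =
      inside-crossing S ae∈S eb∉S (trans (col-ae a b) (cong₂ _xor_ ba (idCol-off b≢a)))
    by-cases (no aa∉S)  (no _)     true  loop = outside-crossing S aa∉S ea∈S (trans (col-a a a) loop)
    by-cases (no _)     (no ae∉S)  false loop =
      outside-crossing S ae∉S ea∈S (trans (col-ae a a) (cong₂ _xor_ loop (idCol-diag a)))

  -- Either S or W − S has no identity column, and any column of it crosses; or the
  -- vertices with e v ∈ S and those with e v ∉ S are joined by an edge.
  rank-sum-exceeds : Connected G → 1 < n → ∀ S → Nonempty S → Nonempty (∁ S) →
                     suc n ≤ rank M S + rank M (∁ S)
  rank-sum-exceeds conn n>1 S (j₀ , j₀∈S) (j₁ , j₁∈∁S) with nonempty? (eTrace S) | nonempty? (∁ (eTrace S))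
  ... | no no-e | _ with column-nonzero conn n>1 j₀
  ...   | u , hot = inside-crossing S j₀∈S (λ eu∈S → no-e (u , eTrace⁺ eu∈S)) hot
  rank-sum-exceeds conn n>1 S _ (j₁ , j₁∈∁S) | yes _ | no all-e with column-nonzero conn n>1 j₁
  ...   | u , hot = outside-crossing S (x∈∁p⇒x∉p j₁∈∁S) (eTrace⁻ (x∉∁p⇒x∈p λ u∈∁ → all-e (u , u∈∁))) hot
  rank-sum-exceeds conn n>1 S _ _ | yes (u , u∈) | yes (w , w∈∁)
    with leaving-edge G (eTrace S) (conn u w) u∈ (x∈∁p⇒x∉p w∈∁)
  ... | a , b , ab , a∈ , b∉ = edge-across S ab (eTrace⁻ a∈) (b∉ ∘ eTrace⁺)

  λ-positive : Connected G → 1 < n → ∀ S → Nonempty S → Nonempty (∁ S) → 0 < λM M S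
  λ-positive conn n>1 S ne ne∁ rewrite rankM≡n = m<n⇒0<n∸m (rank-sum-exceeds conn n>1 S ne ne∁)

module Backward {n : ℕ} (G : Graph n) where

  open GroundSet n
  open IAS-columns G

  tripled : Subset n → Subset (n + (n + n))
  tripled Q = Q ++ (Q ++ Q)

  ∁-tripled : ∀ Q → ∁ (tripled Q) ≡ tripled (∁ Q)
  ∁-tripled Q = trans (map-++ not Q (Q ++ Q)) (cong (∁ Q ++_) (map-++ not Q Q))

  lookup-tripled-e : ∀ Q v → lookup (tripled Q) (eᵢ v) ≡ lookup Q v
  lookup-tripled-e Q v = lookup-++ˡ Q (Q ++ Q) v

  lookup-tripled-a : ∀ Q v → lookup (tripled Q) (aᵢ v) ≡ lookup Q v
  lookup-tripled-a Q v = trans (lookup-++ʳ Q (Q ++ Q) (v ↑ˡ n)) (lookup-++ˡ Q Q v)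

  lookup-tripled-ae : ∀ Q v → lookup (tripled Q) (aeᵢ v) ≡ lookup Q v
  lookup-tripled-ae Q v = trans (lookup-++ʳ Q (Q ++ Q) (n ↑ʳ v)) (lookup-++ʳ Q Q v)

  triple-∈ : ∀ {Q u} → u ∈ Q → eᵢ u ∈ tripled Q × aᵢ u ∈ tripled Q × aeᵢ u ∈ tripled Q
  triple-∈ {Q} {u} u∈Q = ∈-by-lookup (sym (lookup-tripled-e Q u)) u∈Q
                       , ∈-by-lookup (sym (lookup-tripled-a Q u)) u∈Q
                       , ∈-by-lookup (sym (lookup-tripled-ae Q u)) u∈Q

  tripled-supported : ∀ {R} → Closed G R → SupportedIn (col M) (tripled R) R
  tripled-supported {R} closed {j} j∈ {i} hot with block j
  ... | e-block v =
    subst (_∈ R) (sym (idCol-true v i (trans (sym (col-e v i)) hot))) (∈-by-lookup (lookup-tripled-e R v) j∈)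
  ... | a-block v =
    closed (∈-by-lookup (lookup-tripled-a R v) j∈) (trans (Graph.sym G v i) (trans (sym (col-a v i)) hot))
  ... | ae-block v with xor-true (trans (sym (col-ae v i)) hot)
  ...   | inj₁ iv = closed (∈-by-lookup (lookup-tripled-ae R v) j∈) (trans (Graph.sym G v i) iv)
  ...   | inj₂ id = subst (_∈ R) (sym (idCol-true v i id)) (∈-by-lookup (lookup-tripled-ae R v) j∈)

  -- For closed R, S = tripled R has r(S) ≤ |R| and r(W − S) ≤ |W − R|, hence λ(S) = 0.
  λ-tripled : ∀ {R} → Closed G R → λM M (tripled R) ≡ 0
  λ-tripled {R} closed = m≤n⇒m∸n≡0 (begin
    rank M (tripled R) + rank M (∁ (tripled R))  ≡⟨ cong (λ S → rank M (tripled R) + rank M S) (∁-tripled R) ⟩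
    rank M (tripled R) + rank M (tripled (∁ R))  ≤⟨ +-mono-≤ (rank-supported M _ R (tripled-supported closed))
                                                            (rank-supported M _ (∁ R) (tripled-supported closed∁)) ⟩
    ∣ R ∣ + ∣ ∁ R ∣                              ≡⟨ ∣p∣+∣∁p∣≡n R ⟩
    n                                            ≡⟨ sym rankM≡n ⟩
    rankM M                                      ∎)
    where
    open ≤-Reasoning
    closed∁ : Closed G (∁ R)
    closed∁ = Components.Closed-∁ G closed

  -- e u + a u + ae u = 0, so a set containing all three columns of a vertex is dependent.
  triple-dependent : ∀ T u → eᵢ u ∈ T → aᵢ u ∈ T → aeᵢ u ∈ T → Dependent M T
  triple-dependent T u e∈T a∈T ae∈T =
    dependent-witness M T U U⊆T (aeᵢ u , q⊆p∪q _ ⁅ aeᵢ u ⁆ (x∈⁅x⁆ (aeᵢ u))) zero-sum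
    where
    U : Subset (n + (n + n))
    U = (⁅ eᵢ u ⁆ ∪ ⁅ aᵢ u ⁆) ∪ ⁅ aeᵢ u ⁆
    U⊆T : U ⊆ T
    U⊆T k∈ with x∈p∪q⁻ _ ⁅ aeᵢ u ⁆ k∈
    ... | inj₂ k∈ae = ⁅x⁆⊆p ae∈T k∈ae
    ... | inj₁ k∈ea with x∈p∪q⁻ ⁅ eᵢ u ⁆ ⁅ aᵢ u ⁆ k∈ea
    ...   | inj₁ k∈e = ⁅x⁆⊆p e∈T k∈e
    ...   | inj₂ k∈a = ⁅x⁆⊆p a∈T k∈a
    a-new : aᵢ u ∉ ⁅ eᵢ u ⁆
    a-new a∈ = e≢a u u (sym (x∈⁅y⁆⇒x≡y (eᵢ u) a∈))
    ae-new : aeᵢ u ∉ ⁅ eᵢ u ⁆ ∪ ⁅ aᵢ u ⁆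
    ae-new ae∈ with x∈p∪q⁻ ⁅ eᵢ u ⁆ ⁅ aᵢ u ⁆ ae∈
    ... | inj₁ ae∈e = e≢ae u u (sym (x∈⁅y⁆⇒x≡y (eᵢ u) ae∈e))
    ... | inj₂ ae∈a = a≢ae u u (sym (x∈⁅y⁆⇒x≡y (aᵢ u) ae∈a))
    zero-sum : ∀ i → sumCols (col M) U i ≡ false
    zero-sum i = begin
      sumCols (col M) U i
        ≡⟨ xorSum-insert _ (λ j → col M j i) ae-new ⟩
      col M (aeᵢ u) i xor sumCols (col M) (⁅ eᵢ u ⁆ ∪ ⁅ aᵢ u ⁆) i
        ≡⟨ cong (col M (aeᵢ u) i xor_) (xorSum-insert ⁅ eᵢ u ⁆ (λ j → col M j i) a-new) ⟩
      col M (aeᵢ u) i xor (col M (aᵢ u) i xor sumCols (col M) ⁅ eᵢ u ⁆ i)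
        ≡⟨ cong (λ b → col M (aeᵢ u) i xor (col M (aᵢ u) i xor b)) (xorSum-⁅⁆ (eᵢ u) (λ j → col M j i)) ⟩
      col M (aeᵢ u) i xor (col M (aᵢ u) i xor col M (eᵢ u) i)
        ≡⟨ cong₂ _xor_ (col-ae u i) (cong₂ _xor_ (col-a u i) (col-e u i)) ⟩
      (adj G i u xor idCol u i) xor (adj G i u xor idCol u i)
        ≡⟨ xor-same (adj G i u xor idCol u i) ⟩
      false ∎
      where open ≡-Reasoning

  full-side : ∀ {Q u} → u ∈ Q → eᵢ u ∈ tripled Q × Dependent M (tripled Q)
  full-side {Q} {u} u∈Q with triple-∈ u∈Q
  ... | e∈ , a∈ , ae∈ = e∈ , triple-dependent _ u e∈ a∈ ae∈

  cut-separation : ∀ {R u v} → Closed G R → u ∈ R → v ∉ R →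
                   λM M (tripled R) ≡ 0 × (eᵢ u ∈ tripled R × Dependent M (tripled R))
                                        × (eᵢ v ∈ ∁ (tripled R) × Dependent M (∁ (tripled R)))
  cut-separation {R} closed u∈R v∉R =
    λ-tripled closed , full-side u∈R ,
    subst (λ T → _ ∈ T × Dependent M T) (sym (∁-tripled R)) (full-side (x∉p⇒x∈∁p v∉R))

module ConnectedCase {n : ℕ} (G : Graph n) (n>1 : 1 < n) where

  open GroundSet n
  open IAS-columns G
  open Forward G
  open Components G
  open Backward G

  positive : Connected G → PositiveOnSplits M
  positive conn = λ-positive conn n>1

  corank>1 : 1 < cols M ∸ rankM M
  corank>1 rewrite rankM≡n | m+n∸m≡n n (n + n) = <-≤-trans n>1 (m≤m+n n n)

  rank>1 : 1 < rankM M
  rank>1 rewrite rankM≡n = n>1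

  -- Each cut of G is a 1-separation of every kind, so each connectivity notion forces G connected.
  connected-if-twoConnected : TwoConnected M → Connected G
  connected-if-twoConnected h = connected-if-uncut λ closed u∈R v∉R →
    let (λ≡0 , (e∈ , _) , (e∈′ , _)) = cut-separation closed u∈R v∉R
    in  not-twoConnected M _ λ≡0 (_ , e∈) (_ , e∈′) h

  connected-if-cyclic : CyclicallyTwoConnected M → Connected G
  connected-if-cyclic h = connected-if-uncut λ closed u∈R v∉R →
    let (λ≡0 , (_ , dep) , (_ , dep′)) = cut-separation closed u∈R v∉R
    in  not-cyclicallyTwoConnected M _ λ≡0 dep dep′ h

  connected-if-vertical : VerticallyTwoConnected M → Connected G
  connected-if-vertical h = connected-if-uncut λ {_} {u} {v} closed u∈R v∉R →
    let (λ≡0 , (e∈ , _) , (e∈′ , _)) = cut-separation closed u∈R v∉R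
    in  not-verticallyTwoConnected M _ λ≡0 (rank-nonzero-column M _ e∈ (col-e-diag u))
                                           (rank-nonzero-column M _ e∈′ (col-e-diag v)) h

module SingleVertex (G : Graph 1) where

  open GroundSet 1
  open IAS-columns G

  -- With one vertex the columns are e = (1), a = (A₀₀) and ae = (A₀₀ + 1): one of a, ae is
  -- a zero column z and the other, p, equals e.
  loop-and-parallel : ∃ λ z → ∃ λ p → (∀ i → col M z i ≡ false) × (∀ i → col M (eᵢ zero) i ≡ col M p i)
                                      × ¬ p ≡ eᵢ zero × ¬ eᵢ zero ≡ z × ¬ p ≡ z
  loop-and-parallel with adj G zero zero in loop
  ... | false = aᵢ zero , aeᵢ zero
              , (λ { zero → trans (col-a zero zero) loop })
              , (λ { zero → trans (col-e-diag zero)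
                                  (sym (trans (col-ae zero zero) (cong₂ _xor_ loop (idCol-diag {1} zero)))) })
              , (λ eq → e≢ae zero zero (sym eq)) , e≢a zero zero , (λ eq → a≢ae zero zero (sym eq))
  ... | true  = aeᵢ zero , aᵢ zero
              , (λ { zero → trans (col-ae zero zero) (cong₂ _xor_ loop (idCol-diag {1} zero)) })
              , (λ { zero → trans (col-e-diag zero) (sym (trans (col-a zero zero) loop)) })
              , (λ eq → e≢a zero zero (sym eq)) , e≢ae zero zero , a≢ae zero zero

  -- S = {z}: r(S) = 0 and r(W − S) ≤ 1 = r(M), so λ(S) = 0; S is a loop and W − S ⊇ {e, p}.
  loop-separation : ∃ λ S → λM M S ≡ 0 × Dependent M S × Dependent M (∁ S)
  loop-separation with loop-and-parallel
  ... | z , p , zero-col , parallel , p≢e , e≢z , p≢z =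
    ⁅ z ⁆ , m≤n⇒m∸n≡0 rank-sum , loop-dependent M ⁅ z ⁆ (x∈⁅x⁆ z) zero-col ,
    parallel-dependent M _ p≢e (off-z e≢z) (off-z p≢z) parallel
    where
    off-z : ∀ {j} → ¬ j ≡ z → j ∈ ∁ ⁅ z ⁆
    off-z j≢z = x∉p⇒x∈∁p (x≢y⇒x∉⁅y⁆ j≢z)
    rank-z : rank M ⁅ z ⁆ ≤ 0
    rank-z = ≤-trans (rank-supported M ⁅ z ⁆ ⊥ nowhere) (≤-reflexive (∣⊥∣≡0 1))
      where
      nowhere : SupportedIn (col M) ⁅ z ⁆ ⊥
      nowhere j∈ {i} hot rewrite x∈⁅y⁆⇒x≡y z j∈ = contradiction (trans (sym hot) (zero-col i)) λ ()
    rank-sum : rank M ⁅ z ⁆ + rank M (∁ ⁅ z ⁆) ≤ rankM M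
    rank-sum = ≤-trans (+-mono-≤ rank-z (rank-supported M (∁ ⁅ z ⁆) ⊤ λ _ _ → ∈⊤)) (≤-reflexive (sym rankM≡n))

  -- Hence for n = 1 none of the three notions holds; r(M) = 1 excludes vertical 2-connectivity.
  not-twoConnected₁ : ¬ TwoConnected M
  not-twoConnected₁ with loop-separation
  ... | S , λ≡0 , dep , dep∁ =
    not-twoConnected M S λ≡0 (dependent⇒nonempty M S dep) (dependent⇒nonempty M (∁ S) dep∁)

  not-cyclic₁ : ¬ CyclicallyTwoConnected M
  not-cyclic₁ with loop-separation
  ... | S , λ≡0 , dep , dep∁ = not-cyclicallyTwoConnected M S λ≡0 dep dep∁

  not-vertical₁ : ¬ VerticallyTwoConnected M
  not-vertical₁ (_ , rank>1) = <-irrefl refl (subst (1 <_) rankM≡n rank>1)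

proposition13 : (n : ℕ) → 0 < n → (G : Graph n) →
    ((Connected G × 1 < n) ⇔ TwoConnected (IAS G)) ×
    ((Connected G × 1 < n) ⇔ CyclicallyTwoConnected (IAS G)) ×
    ((Connected G × 1 < n) ⇔ VerticallyTwoConnected (IAS G))
proposition13 (suc zero) _ G =
  mk⇔ (λ { (_ , s≤s ()) }) (⊥-elim ∘ not-twoConnected₁) ,
  mk⇔ (λ { (_ , s≤s ()) }) (⊥-elim ∘ not-cyclic₁) ,
  mk⇔ (λ { (_ , s≤s ()) }) (⊥-elim ∘ not-vertical₁)
  where open SingleVertex G
proposition13 (suc (suc k)) _ G =
  mk⇔ (λ (conn , _) → twoConnected-if M (positive conn))
      (λ h → connected-if-twoConnected h , n>1) ,
  mk⇔ (λ (conn , _) → cyclicallyTwoConnected-if M (positive conn) corank>1)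
      (λ h → connected-if-cyclic h , n>1) ,
  mk⇔ (λ (conn , _) → verticallyTwoConnected-if M (positive conn) rank>1)
      (λ h → connected-if-vertical h , n>1)
  where
  n>1 : 1 < suc (suc k)
  n>1 = s≤s (s≤s z≤n)
  open IAS-columns G using (M)
  open ConnectedCase G n>1
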